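{- For every even integer $s_x\ge 0$, we have $k^*(s_x,2)=2\,k^*(s_x,0)$.
   Context: For integers $m\le n$, $[m,n]$ denotes $\{m,\dots,n\}$. A planar additive basis for $R=[0,s_x]\times[0,s_y]$ is a set $A$ of points with non-negative integer coordinates such that $A+A\supseteq R$, where $A+A=\{(x+x',y+y'):(x,y),(x',y')\in A\}$. For even $s_x,s_y$, a basis $A$ is restricted if $A\subseteq[0,s_x/2]\times[0,s_y/2]$, and $k^*(s_x,s_y)$ denotes the minimum cardinality of a restricted planar additive basis for $[0,s_x]\times[0,s_y]$. (In particular $k^*(s_x,0)$ is the minimum size of a set $E\subseteq[0,s_x/2]$ of integers with $E+E\supseteq[0,s_x]$.) -}

module Defs where

open import Data.Nat using (ℕ; _+_; _*_; _≤_; ⌊_/2⌋)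
open import Data.Product using (_×_; _,_; proj₁; proj₂; ∃; ∃-syntax)
open import Data.List using (List; length)
open import Data.List.Relation.Unary.All using (All)
open import Data.List.Relation.Unary.Unique.Propositional using (Unique)
open import Data.List.Membership.Propositional using (_∈_)
open import Relation.Binary.PropositionalEquality using (_≡_)

Point : Set
Point = ℕ × ℕ

-- A finite set of points is represented by a duplicate-free list;
-- its cardinality is the length of the list.

IsBasis : ℕ → ℕ → List Point → Set
IsBasis sx sy A =
  ∀ x y → x ≤ sx → y ≤ sy →
  ∃[ p ] ∃[ q ] (p ∈ A × q ∈ A ×
     proj₁ p + proj₁ q ≡ x × proj₂ p + proj₂ q ≡ y)

IsRestricted : ℕ → ℕ → List Point → Set
IsRestricted sx sy A = All (λ p → proj₁ p ≤ ⌊ sx /2⌋ × proj₂ p ≤ ⌊ sy /2⌋) A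

IsRestrictedBasis : ℕ → ℕ → List Point → Set
IsRestrictedBasis sx sy A = Unique A × IsRestricted sx sy A × IsBasis sx sy A

IsKStar : ℕ → ℕ → ℕ → Set
IsKStar sx sy k =
  (∃[ A ] (IsRestrictedBasis sx sy A × length A ≡ k)) ×
  (∀ A → IsRestrictedBasis sx sy A → k ≤ length A)

-- A restricted basis for [0,sx] × [0,2] has all its points in the rows y = 0 and y = 1.
-- Its bottom row alone must represent [0,sx] × {0}, and its top row, lowered to y = 0,
-- must represent [0,sx] × {2}; both are thus restricted bases for [0,sx] × {0}, giving
-- 2 k*(sx,0) ≤ k*(sx,2).  Conversely a restricted basis E for [0,sx] × {0} together
-- with its copy raised to y = 1 is a restricted basis for [0,sx] × [0,2] of size 2 |E|.
{-# OPTIONS --safe #-}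
module Submission where

open import Defs
open import Level using (0ℓ)
open import Data.Nat using (ℕ; _*_; zero; suc; _+_; _≤_; z≤n; s≤s; _≟_)
open import Data.Bool using (true; false)
open import Data.Nat.Divisibility using (_∣_)
open import Data.Nat.Properties
open import Data.Product using (_×_; _,_; proj₁; proj₂)
open import Data.List using (List; []; _∷_; length; map; filter; _++_)
open import Data.List.Properties using (length-map; length-++)
open import Data.List.Relation.Unary.All as All using (All; []; _∷_)
import Data.List.Relation.Unary.All.Properties as All
open import Data.List.Relation.Unary.Unique.Propositional using (Unique; []; _∷_)
import Data.List.Relation.Unary.Unique.Propositional.Properties as Unique
open import Data.List.Membership.Propositional using (_∈_)
open import Data.List.Membership.Propositional.Properties using (∈-++⁺ˡ; ∈-++⁺ʳ; ∈-map⁺; ∈-map⁻; ∈-filter⁺)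
open import Relation.Binary.PropositionalEquality
open import Relation.Nullary using (¬_; does)
open import Relation.Unary using (Pred; Decidable)
open import Relation.Unary.Properties using (∁?)

map⁺-injectiveOn : {A B : Set} {P : Pred A 0ℓ} {f : A → B} →
                   (∀ {a b} → P a → P b → f a ≡ f b → a ≡ b) →
                   ∀ {xs} → All P xs → Unique xs → Unique (map f xs)
map⁺-injectiveOn inj [] [] = []
map⁺-injectiveOn {P = P} {f} inj (px ∷ pxs) (x∉xs ∷ u) =
  fx∉ px pxs x∉xs ∷ map⁺-injectiveOn inj pxs u
  where
  fx∉ : ∀ {x ys} → P x → All P ys → All (λ y → ¬ x ≡ y) ys → All (λ y → ¬ f x ≡ y) (map f ys)
  fx∉ px [] [] = []
  fx∉ px (py ∷ pys) (x≢y ∷ x∉ys) = (λ fx≡fy → x≢y (inj px py fx≡fy)) ∷ fx∉ px pys x∉ys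

length-filter-∁ : {A : Set} {P : Pred A 0ℓ} (P? : Decidable P) → ∀ xs →
                  length (filter P? xs) + length (filter (∁? P?) xs) ≡ length xs
length-filter-∁ P? [] = refl
length-filter-∁ P? (x ∷ xs) with does (P? x)
... | true  = cong suc (length-filter-∁ P? xs)
... | false = trans (+-suc _ _) (cong suc (length-filter-∁ P? xs))

m+n≡2⇒m≢0 : ∀ {m n} → n ≤ 1 → m + n ≡ 2 → m ≢ 0
m+n≡2⇒m≢0 (s≤s ()) refl refl

raise : Point → Point
raise (x , y) = x , suc y

ground : Point → Point
ground (x , _) = x , 0

raise-injective : ∀ {p q} → raise p ≡ raise q → p ≡ q
raise-injective refl = refl

ground-injectiveOnRow : ∀ {c p q} → proj₂ p ≡ c → proj₂ q ≡ c → ground p ≡ ground q → p ≡ q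
ground-injectiveOnRow {p = _ , _} {_ , _} refl refl refl = refl

IsBasis-raise : ∀ {sx E} → IsBasis sx 0 E → IsBasis sx 2 (E ++ map raise E)
IsBasis-raise {E = E} basis x y x≤sx y≤2 with basis x 0 x≤sx z≤n
... | p , q , p∈E , q∈E , x≡ , y≡0 with y≤2
...   | z≤n             = p , q , ∈-++⁺ˡ p∈E , ∈-++⁺ˡ q∈E , x≡ , y≡0
...   | s≤s z≤n         =
  p , raise q , ∈-++⁺ˡ p∈E , ∈-++⁺ʳ E (∈-map⁺ raise q∈E) , x≡ ,
  trans (+-suc (proj₂ p) (proj₂ q)) (cong suc y≡0)
...   | s≤s (s≤s z≤n)   =
  raise p , raise q , ∈-++⁺ʳ E (∈-map⁺ raise p∈E) , ∈-++⁺ʳ E (∈-map⁺ raise q∈E) , x≡ ,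
  cong suc (trans (+-suc (proj₂ p) (proj₂ q)) (cong suc y≡0))

IsRestrictedBasis-raise : ∀ {sx E} → IsRestrictedBasis sx 0 E →
                          IsRestrictedBasis sx 2 (E ++ map raise E)
IsRestrictedBasis-raise {E = E} (unique , restricted , basis) =
  Unique.++⁺ unique (Unique.map⁺ raise-injective unique) disjoint ,
  All.++⁺ (All.map (λ (x≤ , y≤0) → x≤ , m≤n⇒m≤1+n y≤0) restricted)
          (All.map⁺ (All.map (λ (x≤ , y≤0) → x≤ , s≤s y≤0) restricted)) ,
  IsBasis-raise basis
  where
  disjoint : ∀ {v} → ¬ (v ∈ E × v ∈ map raise E)
  disjoint (v∈E , v∈raisedE) with ∈-map⁻ raise v∈raisedE
  ... | _ , _ , refl with proj₂ (All.lookup restricted v∈E)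
  ... | ()

module Rows {sx : ℕ} {A : List Point} (RB : IsRestrictedBasis sx 2 A) where

  unique : Unique A
  unique = proj₁ RB

  restricted : IsRestricted sx 2 A
  restricted = proj₁ (proj₂ RB)

  basis : IsBasis sx 2 A
  basis = proj₂ (proj₂ RB)

  onRow0? : Decidable (λ (p : Point) → proj₂ p ≡ 0)
  onRow0? p = proj₂ p ≟ 0

  bottom : List Point
  bottom = filter onRow0? A

  offRow0 : List Point
  offRow0 = filter (∁? onRow0?) A

  top : List Point
  top = map ground offRow0

  y≤1 : ∀ {p} → p ∈ A → proj₂ p ≤ 1
  y≤1 p∈A = proj₂ (All.lookup restricted p∈A)

  bottom-restrictedBasis : IsRestrictedBasis sx 0 bottom
  bottom-restrictedBasis =
    Unique.filter⁺ onRow0? unique ,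
    All.zipWith (λ ((x≤ , _) , y≡0) → x≤ , ≤-reflexive y≡0)
                (All.filter⁺ onRow0? restricted , All.all-filter onRow0? A) ,
    bottom-basis
    where
    bottom-basis : IsBasis sx 0 bottom
    bottom-basis x zero x≤sx z≤n with basis x 0 x≤sx z≤n
    ... | p , q , p∈A , q∈A , x≡ , y≡0 =
      p , q , ∈-filter⁺ onRow0? p∈A (m+n≡0⇒m≡0 _ y≡0) ,
              ∈-filter⁺ onRow0? q∈A (m+n≡0⇒n≡0 _ y≡0) , x≡ , y≡0

  top-restrictedBasis : IsRestrictedBasis sx 0 top
  top-restrictedBasis =
    map⁺-injectiveOn ground-injectiveOnRow onRow1 (Unique.filter⁺ (∁? onRow0?) unique) ,
    All.map⁺ (All.map (λ (x≤ , _) → x≤ , z≤n) (All.filter⁺ (∁? onRow0?) restricted)) ,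
    top-basis
    where
    onRow1 : All (λ p → proj₂ p ≡ 1) offRow0
    onRow1 = All.zipWith (λ ((_ , y≤1) , y≢0) → ≤-antisym y≤1 (n≢0⇒n>0 y≢0))
                         (All.filter⁺ (∁? onRow0?) restricted , All.all-filter (∁? onRow0?) A)
    top-basis : IsBasis sx 0 top
    top-basis x zero x≤sx z≤n with basis x 2 x≤sx ≤-refl
    ... | p , q , p∈A , q∈A , x≡ , y≡2 =
      ground p , ground q ,
      ∈-map⁺ ground (∈-filter⁺ (∁? onRow0?) p∈A (m+n≡2⇒m≢0 (y≤1 q∈A) y≡2)) ,
      ∈-map⁺ ground (∈-filter⁺ (∁? onRow0?) q∈A
        (m+n≡2⇒m≢0 (y≤1 p∈A) (trans (+-comm (proj₂ q) (proj₂ p)) y≡2))) ,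
      x≡ , refl

  length-rows : length bottom + length top ≡ length A
  length-rows =
    trans (cong (length bottom +_) (length-map ground offRow0)) (length-filter-∁ onRow0? A)

lemma3 : ∀ (sx k : ℕ) → 2 ∣ sx → IsKStar sx 0 k → IsKStar sx 2 (2 * k)
lemma3 sx k _ ((E , E-basis , ∣E∣≡k) , k-minimal) =
  (E ++ map raise E , IsRestrictedBasis-raise E-basis , length-doubled) , lower-bound
  where
  k+k≡2k : k + k ≡ 2 * k
  k+k≡2k = cong (k +_) (sym (+-identityʳ k))

  length-doubled : length (E ++ map raise E) ≡ 2 * k
  length-doubled = begin
    length (E ++ map raise E)       ≡⟨ length-++ E ⟩
    length E + length (map raise E) ≡⟨ cong (length E +_) (length-map raise E) ⟩
    length E + length E             ≡⟨ cong₂ _+_ ∣E∣≡k ∣E∣≡k ⟩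
    k + k                           ≡⟨ k+k≡2k ⟩
    2 * k                           ∎
    where open ≡-Reasoning

  lower-bound : ∀ A → IsRestrictedBasis sx 2 A → 2 * k ≤ length A
  lower-bound A A-basis = subst₂ _≤_ k+k≡2k length-rows
    (+-mono-≤ (k-minimal bottom bottom-restrictedBasis) (k-minimal top top-restrictedBasis))
    where open Rows A-basis
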